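{- Let $P$ be a finite poset, $\mathbb{S}$ a skew field containing an infinite field as a subfield, $C$ a central element of $\mathbb{S}$, and $v\in P$ with $v_1,\dots,v_k$ the elements of $P$ covered by $v$. Let $T_v^*=\varepsilon_{v_1}\varepsilon_{v_2}\cdots\varepsilon_{v_k}\tau_v\tau_{v_k}\cdots\tau_{v_2}\tau_{v_1}$ and $E_v^*=\varepsilon_{v_1}\varepsilon_{v_2}\cdots\varepsilon_{v_k}\varepsilon_v\tau_{v_k}\cdots\tau_{v_2}\tau_{v_1}$ (for minimal $v$, $T_v^*=\tau_v$, $E_v^*=\varepsilon_v$). Then, on the domains where the maps are defined, $$\Theta\circ\Delta^{ -1}\circ T_v^*=T_v\circ\Theta\circ\Delta^{ -1}\quad\text{and}\quad\Theta\circ\Delta^{ -1}\circ E_v^*=E_v\circ\Theta\circ\Delta^{ -1}.$$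
   Context: $\mathbb{S}^P$ is the set of labelings $P\to\mathbb{S}$; products denote composition, rightmost first; $\overline{x}=x^{ -1}$; the parallel sum of $z_1,\dots,z_m$ is $\sum^{\parallel}_iz_i=\overline{\overline{z_1}+\cdots+\overline{z_m}}$. $\widehat P$ is $P$ with a new minimum $\widehat0$ and maximum $\widehat1$; $x\lessdot y$ means $y$ covers $x$ in $\widehat P$. Order toggle $T_v$ / elggot $E_v$ change only the label at $v$: $(T_vf)(v)=\big(\sum_{u\lessdot v}f(u)\big)\overline{f(v)}\big(\sum^{\parallel}_{u\gtrdot v}f(u)\big)$, $(E_vf)(v)=\big(\sum^{\parallel}_{u\gtrdot v}f(u)\big)\overline{f(v)}\big(\sum_{u\lessdot v}f(u)\big)$, with $f(\widehat0)=1$, $f(\widehat1)=C$. Antichain toggle $\tau_v$ / elggot $\varepsilon_v$ change only the label at $v$: $(\tau_vg)(v)=C\cdot\overline{\sum g(y_{c-1})\cdots g(y_1)\,g(y_k)\cdots g(y_c)}$, $(\varepsilon_vg)(v)=C\cdot\overline{\sum g(y_c)\cdots g(y_1)\,g(y_k)\cdots g(y_{c+1})}$, sums over maximal chains $y_1\lessdot\cdots\lessdot y_k$ of $P$ with $y_c=v$. $(\Theta f)(x)=C\,\overline{f(x)}$; $(\Delta^{ -1}f)(x)=\sum f(y_k)\cdots f(y_2)f(y_1)$ over chains $x=y_1\lessdot y_2\lessdot\cdots\lessdot y_k\lessdot\widehat1$. -}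

module Defs where

open import Level using (Level; _⊔_; 0ℓ) renaming (suc to lsuc)
open import Data.Nat using (ℕ; zero; suc)
open import Data.Fin using (Fin)
open import Data.Fin.Properties using (any?)
open import Data.List using (List; []; _∷_; map; foldr; filter; allFin; concatMap; reverse; drop; _++_)
open import Data.List.Membership.Propositional using (_∈_)
open import Data.List.Relation.Unary.Unique.Propositional using (Unique)
open import Data.List.Relation.Unary.All using (All)
open import Data.Product using (Σ; ∃; _×_; _,_; proj₁; proj₂)
open import Data.Unit.Polymorphic using (⊤)
open import Data.Bool using (if_then_else_)
open import Relation.Nullary using (¬_; Dec; does; ¬?)
open import Relation.Nullary.Decidable using (_×-dec_)
open import Relation.Binary using (Rel; IsDecPartialOrder; Decidable)
open import Relation.Binary.PropositionalEquality using (_≡_; _≢_)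
open import Relation.Unary using (Pred)
open import Function.Bundles using (_⇔_)
open import Algebra.Bundles using (Ring)

-- Skew fields (division rings).  The inverse is a total function whose
-- value is only constrained (and only ever used) on nonzero elements.

record SkewField (c ℓ : Level) : Set (lsuc (c ⊔ ℓ)) where
  field
    ring : Ring c ℓ
  open Ring ring public
  field
    _⁻¹      : Carrier → Carrier
    0≉1      : ¬ (0# ≈ 1#)
    inverseʳ : ∀ x → ¬ (x ≈ 0#) → x * (x ⁻¹) ≈ 1#
    inverseˡ : ∀ x → ¬ (x ≈ 0#) → (x ⁻¹) * x ≈ 1#

record InfiniteSubfield {c ℓ} (S : SkewField c ℓ) (k : Level) : Set (c ⊔ ℓ ⊔ lsuc k) where
  open SkewField S
  field
    K        : Pred Carrier k
    K-resp   : ∀ {x y} → x ≈ y → K x → K y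
    K-0      : K 0#
    K-1      : K 1#
    K-+      : ∀ {x y} → K x → K y → K (x + y)
    K-neg    : ∀ {x} → K x → K (- x)
    K-*      : ∀ {x y} → K x → K y → K (x * y)
    K-inv    : ∀ {x} → K x → ¬ (x ≈ 0#) → K (x ⁻¹)
    K-comm   : ∀ {x y} → K x → K y → x * y ≈ y * x
    K-infinite : (xs : List Carrier) → ∃ λ a → K a × All (λ x → ¬ (a ≈ x)) xs

Central : ∀ {c ℓ} (S : SkewField c ℓ) → SkewField.Carrier S → Set (c ⊔ ℓ)
Central S C = ∀ x → C * x ≈ x * C
  where open SkewField S

record FinPoset : Set₁ where
  field
    n   : ℕ
    _≤_ : Rel (Fin n) 0ℓ
    isDecPartialOrder : IsDecPartialOrder _≡_ _≤_
  open IsDecPartialOrder isDecPartialOrder public using (_≤?_) renaming (_≟_ to _≟P_)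

  Elt : Set
  Elt = Fin n

  _<_ : Rel Elt 0ℓ
  x < y = x ≤ y × x ≢ y

  _<?_ : Decidable _<_
  x <? y = (x ≤? y) ×-dec ¬? (x ≟P y)

  _⋖_ : Rel Elt 0ℓ
  x ⋖ y = x < y × ¬ (∃ λ z → x < z × z < y)

  _⋖?_ : Decidable _⋖_
  x ⋖? y = (x <? y) ×-dec ¬? (any? (λ z → (x <? z) ×-dec (z <? y)))

  lowerCovers : Elt → List Elt
  lowerCovers v = filter (λ u → u ⋖? v) (allFin n)

  upperCovers : Elt → List Elt
  upperCovers v = filter (λ u → v ⋖? u) (allFin n)

  IsLowerCoverList : Elt → List Elt → Set
  IsLowerCoverList v vs = Unique vs × (∀ u → (u ∈ vs) ⇔ (u ⋖ v))

  -- saturated chains  x = y₁ ⋖ y₂ ⋖ ⋯ ⋖ yₖ  with yₖ maximal in P, as [y₁,…,yₖ].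
  -- The fuel argument n suffices since chains in P have at most n elements.
  upChainsF : ℕ → Elt → List (List Elt)
  upChainsF zero x = []
  upChainsF (suc k) x = go (upperCovers x)
    where
    go : List Elt → List (List Elt)
    go [] = (x ∷ []) ∷ []
    go ys@(_ ∷ _) = concatMap (λ y → map (x ∷_) (upChainsF k y)) ys

  -- saturated chains  x = y_c ⋗ y_{c-1} ⋗ ⋯ ⋗ y₁ with y₁ minimal, as [y_c,…,y₁].
  downChainsF : ℕ → Elt → List (List Elt)
  downChainsF zero x = []
  downChainsF (suc k) x = go (lowerCovers x)
    where
    go : List Elt → List (List Elt)
    go [] = (x ∷ []) ∷ []
    go ys@(_ ∷ _) = concatMap (λ y → map (x ∷_) (downChainsF k y)) ys

  upChains : Elt → List (List Elt)
  upChains = upChainsF n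

  downChains : Elt → List (List Elt)
  downChains = downChainsF n

-- Partial computations: a value together with the condition (a
-- proposition) under which it is defined, i.e. all inverted elements
-- are nonzero.

Pt : ∀ {a} (ℓ : Level) → Set a → Set (a ⊔ lsuc ℓ)
Pt ℓ A = Set ℓ × A

module _ {ℓ : Level} where
  ret : ∀ {a} {A : Set a} → A → Pt ℓ A
  ret x = ⊤ , x

  _>>=_ : ∀ {a b} {A : Set a} {B : Set b} → Pt ℓ A → (A → Pt ℓ B) → Pt ℓ B
  m >>= f = (proj₁ m × proj₁ (f (proj₂ m))) , proj₂ (f (proj₂ m))

  seqM : ∀ {a} {A : Set a} → List (Pt ℓ A) → Pt ℓ (List A)
  seqM [] = ret []
  seqM (m ∷ ms) = m >>= λ x → seqM ms >>= λ xs → ret (x ∷ xs)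

module Maps {c ℓ} (S : SkewField c ℓ) (P : FinPoset) (C : SkewField.Carrier S) where
  open SkewField S
  open FinPoset P

  Lab : Set c
  Lab = Elt → Carrier

  sumL : List Carrier → Carrier
  sumL = foldr _+_ 0#

  prodL : List Carrier → Carrier
  prodL = foldr _*_ 1#

  inv? : Carrier → Pt ℓ Carrier
  inv? x = (¬ (x ≈ 0#)) , (x ⁻¹)

  -- parallel sum  \overline{\overline{z₁}+⋯+\overline{zₘ}}
  psum : List Carrier → Pt ℓ Carrier
  psum zs = seqM (map inv? zs) >>= λ ws → inv? (sumL ws)

  update : Lab → Elt → Carrier → Lab
  update f v a u = if does (u ≟P v) then a else f u

  -- labels of the elements covered by v in \hat P (f(\hat 0) = 1)
  hatLower : Lab → List Elt → List Carrier
  hatLower f [] = 1# ∷ []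
  hatLower f us@(_ ∷ _) = map f us

  -- labels of the elements covering v in \hat P (f(\hat 1) = C)
  hatUpper : Lab → List Elt → List Carrier
  hatUpper f [] = C ∷ []
  hatUpper f us@(_ ∷ _) = map f us

  T : Elt → Lab → Pt ℓ Lab
  T v f = inv? (f v) >>= λ a → psum (hatUpper f (upperCovers v)) >>= λ b →
          ret (update f v ((sumL (hatLower f (lowerCovers v)) * a) * b))

  E : Elt → Lab → Pt ℓ Lab
  E v f = inv? (f v) >>= λ a → psum (hatUpper f (upperCovers v)) >>= λ b →
          ret (update f v ((b * a) * sumL (hatLower f (lowerCovers v))))

  -- A maximal chain y₁ ⋖ ⋯ ⋖ yₖ of P with y_c = v corresponds exactly to a
  -- pair (d , u) with d = [y_c,…,y₁] ∈ downChains v, u = [y_c,…,yₖ] ∈ upChains v.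

  -- Σ g(y_{c-1})⋯g(y₁) g(yₖ)⋯g(y_c)
  τsum : Lab → Elt → Carrier
  τsum g v = sumL (concatMap (λ d → map (λ u →
               prodL (map g (drop 1 d)) * prodL (map g (reverse u))) (upChains v)) (downChains v))

  -- Σ g(y_c)⋯g(y₁) g(yₖ)⋯g(y_{c+1})
  εsum : Lab → Elt → Carrier
  εsum g v = sumL (concatMap (λ d → map (λ u →
               prodL (map g d) * prodL (map g (reverse (drop 1 u)))) (upChains v)) (downChains v))

  τ : Elt → Lab → Pt ℓ Lab
  τ v g = inv? (τsum g v) >>= λ a → ret (update g v (C * a))

  ε : Elt → Lab → Pt ℓ Lab
  ε v g = inv? (εsum g v) >>= λ a → ret (update g v (C * a))

  Θ : Lab → Pt ℓ Lab
  Θ f = (∀ x → ¬ (f x ≈ 0#)) , (λ x → C * (f x ⁻¹))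

  Δinv : Lab → Lab
  Δinv f x = sumL (map (λ ch → prodL (map f (reverse ch))) (upChains x))

  -- composition of a list of partial maps, rightmost applied first
  compose : List (Lab → Pt ℓ Lab) → Lab → Pt ℓ Lab
  compose [] g = ret g
  compose (h ∷ hs) g = compose hs g >>= h

  Tstar : Elt → List Elt → Lab → Pt ℓ Lab
  Tstar v vs = compose (map ε vs ++ (τ v ∷ map τ (reverse vs)))

  Estar : Elt → List Elt → Lab → Pt ℓ Lab
  Estar v vs = compose (map ε vs ++ (ε v ∷ map τ (reverse vs)))

  ΘΔ : Lab → Pt ℓ Lab
  ΘΔ f = Θ (Δinv f)

  AgreeOnDomains : (Lab → Pt ℓ Lab) → (Lab → Pt ℓ Lab) → Set (c ⊔ ℓ)
  AgreeOnDomains F G = ∀ g → proj₁ (F g) → proj₁ (G g) → ∀ x → proj₂ (F g) x ≈ proj₂ (G g) x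

  lhsT rhsT lhsE rhsE : Elt → List Elt → Lab → Pt ℓ Lab
  lhsT v vs g = Tstar v vs g >>= ΘΔ
  rhsT v vs g = ΘΔ g >>= T v
  lhsE v vs g = Estar v vs g >>= ΘΔ
  rhsE v vs g = ΘΔ g >>= E v

module Submission where

-- Write F = Δ⁻¹h.  Splitting chains at their first element gives
-- F(x) = U(x)·h(x), with U(x) the sum of F over the upper covers of x, and
-- dually D(x) = h(x)·A(x) for the downward chain sum D; splitting maximal
-- chains at x gives τsum(x) = A(x)·F(x) and εsum(x) = D(x)·U(x).  Hence
-- these sums are local (F sees only the up-set of x, D the down-set, the
-- antichain sums only elements comparable to x), so toggling the antichain
-- of lower covers v₁,…,vₖ one at a time is a simultaneous toggle.  Tracing
-- the labeling through the three phases of T*_v / E*_v with these formulas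
-- shows that Δ⁻¹ is unchanged away from v, and at v a skew-field computation
-- with the involution ι(z) = C z⁻¹ (Θ is pointwise ι) gives the order toggle.

open import Defs
open import Level using (Level; 0ℓ; _⊔_)
open import Function.Base using (_∘_; flip)
open import Data.Nat as ℕ using (ℕ; zero; suc)
import Data.Nat.Properties as ℕP
import Data.Fin as Fin
open import Data.Fin.Properties using (injective⇒≤)
open import Data.Fin.Induction using (po-wellFounded; po-noetherian)
import Induction.WellFounded as WF
open import Data.List using (List; []; _∷_; foldr; map; concatMap; _++_; length; drop; reverse; lookup; allFin; [_])
import Data.List.Properties as ListP
open import Data.List.Membership.Propositional using (_∈_; _∉_)
open import Data.List.Membership.Propositional.Properties using (∈-filter⁻; ∈-lookup)
open import Data.List.Relation.Unary.Any using (here; there)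
import Data.List.Relation.Unary.Any.Properties as AnyP
open import Data.List.Relation.Unary.All as All using (All; []; _∷_)
open import Data.List.Relation.Unary.AllPairs using ([]; _∷_)
open import Data.List.Relation.Unary.Unique.Propositional using (Unique)
open import Data.Product using (Σ; _×_; _,_; proj₁; proj₂)
open import Data.Sum using (_⊎_; inj₁; inj₂)
open import Data.Empty using (⊥-elim)
open import Data.Unit.Polymorphic using (tt)
open import Relation.Nullary using (¬_; yes; no)
open import Relation.Binary using (Rel; IsDecPartialOrder)
open import Algebra.Bundles using (Semiring)
open import Relation.Binary.PropositionalEquality as ≡ using (_≡_; _≢_)
open import Function.Bundles using (Equivalence)

module ListSums {c ℓ} (R : Semiring c ℓ) where
  open Semiring R
  open import Relation.Binary.Reasoning.Setoid setoid

  sumL : List Carrier → Carrier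
  sumL = foldr _+_ 0#

  prodL : List Carrier → Carrier
  prodL = foldr _*_ 1#

  sum-++ : ∀ xs ys → sumL (xs ++ ys) ≈ sumL xs + sumL ys
  sum-++ [] ys = sym (+-identityˡ _)
  sum-++ (x ∷ xs) ys = trans (+-congˡ (sum-++ xs ys)) (sym (+-assoc _ _ _))

  prod-++ : ∀ xs ys → prodL (xs ++ ys) ≈ prodL xs * prodL ys
  prod-++ [] ys = sym (*-identityˡ _)
  prod-++ (x ∷ xs) ys = trans (*-congˡ (prod-++ xs ys)) (sym (*-assoc _ _ _))

  sum-cong∈ : ∀ {A : Set} (f g : A → Carrier) zs → (∀ z → z ∈ zs → f z ≈ g z) →
              sumL (map f zs) ≈ sumL (map g zs)
  sum-cong∈ f g [] _ = refl
  sum-cong∈ f g (z ∷ zs) f≈g = +-cong (f≈g z (here ≡.refl)) (sum-cong∈ f g zs (λ w p → f≈g w (there p)))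

  sum-*ʳ : ∀ {A : Set} (f : A → Carrier) k zs → sumL (map (λ z → f z * k) zs) ≈ sumL (map f zs) * k
  sum-*ʳ f k [] = sym (zeroˡ k)
  sum-*ʳ f k (z ∷ zs) = trans (+-congˡ (sum-*ʳ f k zs)) (sym (distribʳ _ _ _))

  sum-*ˡ : ∀ {A : Set} (f : A → Carrier) k zs → sumL (map (λ z → k * f z) zs) ≈ k * sumL (map f zs)
  sum-*ˡ f k [] = sym (zeroʳ k)
  sum-*ˡ f k (z ∷ zs) = trans (+-congˡ (sum-*ˡ f k zs)) (sym (distribˡ _ _ _))

  sum-concatMap : ∀ {A B : Set} (φ : B → Carrier) (f : A → List B) ys →
    sumL (map φ (concatMap f ys)) ≈ sumL (map (λ y → sumL (map φ (f y))) ys)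
  sum-concatMap φ f [] = refl
  sum-concatMap φ f (y ∷ ys) = begin
    sumL (map φ (f y ++ concatMap f ys))         ≡⟨ ≡.cong sumL (ListP.map-++ φ (f y) _) ⟩
    sumL (map φ (f y) ++ map φ (concatMap f ys)) ≈⟨ sum-++ (map φ (f y)) _ ⟩
    _                                            ≈⟨ +-congˡ (sum-concatMap φ f ys) ⟩
    _                                            ∎

  sum-product : ∀ {A B : Set} (a : A → Carrier) (b : B → Carrier) ds us →
    sumL (concatMap (λ d → map (λ u → a d * b u) us) ds) ≈ sumL (map a ds) * sumL (map b us)
  sum-product a b [] us = sym (zeroˡ _)
  sum-product a b (d ∷ ds) us = begin
    sumL (map (λ u → a d * b u) us ++ concatMap (λ d → map (λ u → a d * b u) us) ds)
      ≈⟨ sum-++ (map (λ u → a d * b u) us) _ ⟩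
    _ ≈⟨ +-cong (sum-*ˡ b (a d) us) (sum-product a b ds us) ⟩
    _ ≈⟨ sym (distribʳ _ _ _) ⟩
    sumL (map a (d ∷ ds)) * sumL (map b us) ∎

module DivisionRing {c ℓ} (S : SkewField c ℓ) where
  open SkewField S
  open import Relation.Binary.Reasoning.Setoid setoid

  NZ : Carrier → Set ℓ
  NZ x = ¬ (x ≈ 0#)

  nz-resp : ∀ {x y} → x ≈ y → NZ x → NZ y
  nz-resp x≈y x≠0 y≈0 = x≠0 (trans x≈y y≈0)

  nz-*ˡ : ∀ {a b} → NZ (a * b) → NZ a
  nz-*ˡ {a} {b} ab≠0 a≈0 = ab≠0 (trans (*-congʳ a≈0) (zeroˡ b))

  nz-*ʳ : ∀ {a b} → NZ (a * b) → NZ b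
  nz-*ʳ {a} {b} ab≠0 b≈0 = ab≠0 (trans (*-congˡ b≈0) (zeroʳ a))

  cancelˡ : ∀ {a} x → NZ a → a ⁻¹ * (a * x) ≈ x
  cancelˡ {a} x a≠0 = trans (sym (*-assoc _ _ _)) (trans (*-congʳ (inverseˡ a a≠0)) (*-identityˡ x))

  cancelʳ : ∀ {a} x → NZ a → (x * a) * a ⁻¹ ≈ x
  cancelʳ {a} x a≠0 = trans (*-assoc _ _ _) (trans (*-congˡ (inverseʳ a a≠0)) (*-identityʳ x))

  cancelʳ′ : ∀ {a} x → NZ a → (x * a ⁻¹) * a ≈ x
  cancelʳ′ {a} x a≠0 = trans (*-assoc _ _ _) (trans (*-congˡ (inverseˡ a a≠0)) (*-identityʳ x))

  nz-* : ∀ {a b} → NZ a → NZ b → NZ (a * b)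
  nz-* {a} {b} a≠0 b≠0 ab≈0 = b≠0 (begin
    b              ≈⟨ sym (cancelˡ b a≠0) ⟩
    a ⁻¹ * (a * b) ≈⟨ *-congˡ ab≈0 ⟩
    a ⁻¹ * 0#      ≈⟨ zeroʳ _ ⟩
    0#             ∎)

  nz-inv : ∀ {a} → NZ a → NZ (a ⁻¹)
  nz-inv {a} a≠0 a⁻¹≈0 = 0≉1 (begin
    0#       ≈⟨ sym (zeroʳ a) ⟩
    a * 0#   ≈⟨ *-congˡ (sym a⁻¹≈0) ⟩
    a * a ⁻¹ ≈⟨ inverseʳ a a≠0 ⟩
    1#       ∎)

  inv-unique : ∀ {a b} → NZ a → a * b ≈ 1# → b ≈ a ⁻¹
  inv-unique {a} {b} a≠0 ab≈1 = begin
    b              ≈⟨ sym (cancelˡ b a≠0) ⟩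
    a ⁻¹ * (a * b) ≈⟨ *-congˡ ab≈1 ⟩
    a ⁻¹ * 1#      ≈⟨ *-identityʳ _ ⟩
    a ⁻¹           ∎

  inv-cong : ∀ {a b} → NZ a → a ≈ b → a ⁻¹ ≈ b ⁻¹
  inv-cong {a} {b} a≠0 a≈b =
    inv-unique (nz-resp a≈b a≠0) (trans (*-congʳ (sym a≈b)) (inverseʳ a a≠0))

  inv-* : ∀ {a b} → NZ a → NZ b → (a * b) ⁻¹ ≈ b ⁻¹ * a ⁻¹
  inv-* {a} {b} a≠0 b≠0 = sym (inv-unique (nz-* a≠0 b≠0) (begin
    (a * b) * (b ⁻¹ * a ⁻¹) ≈⟨ *-assoc _ _ _ ⟩
    a * (b * (b ⁻¹ * a ⁻¹)) ≈⟨ *-congˡ (sym (*-assoc _ _ _)) ⟩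
    a * ((b * b ⁻¹) * a ⁻¹) ≈⟨ *-congˡ (*-congʳ (inverseʳ b b≠0)) ⟩
    a * (1# * a ⁻¹)         ≈⟨ *-congˡ (*-identityˡ _) ⟩
    a * a ⁻¹                ≈⟨ inverseʳ a a≠0 ⟩
    1#                      ∎))

  inv-inv : ∀ {a} → NZ a → (a ⁻¹) ⁻¹ ≈ a
  inv-inv {a} a≠0 = sym (inv-unique (nz-inv a≠0) (inverseˡ a a≠0))

  -- ι z = C z⁻¹ is the map applied pointwise by Θ
  module Twist (C : Carrier) where

    ι : Carrier → Carrier
    ι z = C * z ⁻¹

    ι-cong : ∀ {a b} → NZ a → a ≈ b → ι a ≈ ι b
    ι-cong a≠0 a≈b = *-congˡ (inv-cong a≠0 a≈b)

    ι-*ʳ : ∀ {a b} → NZ a → NZ b → ι (a * b) ≈ ι b * a ⁻¹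
    ι-*ʳ a≠0 b≠0 = trans (*-congˡ (inv-* a≠0 b≠0)) (sym (*-assoc _ _ _))

    -- the label ι (a f) times a, used for D = h · A on a toggled cover
    ι-absorb : ∀ {a f} → NZ a → NZ f → ι (a * f) * a ≈ ι f
    ι-absorb {a} {f} a≠0 f≠0 = trans (*-congʳ (ι-*ʳ a≠0 f≠0)) (cancelʳ′ (ι f) a≠0)

    module Laws (cen : ∀ x → C * x ≈ x * C) (C≠0 : NZ C) where

      ι-nz : ∀ {z} → NZ z → NZ (ι z)
      ι-nz z≠0 = nz-* C≠0 (nz-inv z≠0)

      ι-inverse : ∀ {z} → NZ z → ι z ⁻¹ ≈ z * C ⁻¹
      ι-inverse z≠0 = trans (inv-* C≠0 (nz-inv z≠0)) (*-congʳ (inv-inv z≠0))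

      C-conj : ∀ x → (C * x) * C ⁻¹ ≈ x
      C-conj x = trans (*-congʳ (cen x)) (cancelʳ x C≠0)

      ι-involutive : ∀ {z} → NZ z → ι (ι z) ≈ z
      ι-involutive {z} z≠0 = begin
        C * ι z ⁻¹       ≈⟨ *-congˡ (ι-inverse z≠0) ⟩
        C * (z * C ⁻¹)   ≈⟨ sym (*-assoc _ _ _) ⟩
        (C * z) * C ⁻¹   ≈⟨ C-conj z ⟩
        z                ∎

      ι-*ˡ : ∀ {a b} → NZ a → NZ b → ι (a * b) ≈ b ⁻¹ * ι a
      ι-*ˡ {a} {b} a≠0 b≠0 = begin
        C * (a * b) ⁻¹     ≈⟨ *-congˡ (inv-* a≠0 b≠0) ⟩
        C * (b ⁻¹ * a ⁻¹)  ≈⟨ sym (*-assoc _ _ _) ⟩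
        (C * b ⁻¹) * a ⁻¹  ≈⟨ *-congʳ (cen _) ⟩
        (b ⁻¹ * C) * a ⁻¹  ≈⟨ *-assoc _ _ _ ⟩
        b ⁻¹ * ι a         ∎

      -- Θ sends the label 1 of \hat 0 to the label C of \hat 1
      ι-one : ι 1# ≈ C
      ι-one = trans (*-congˡ (sym (inv-unique (λ 1≈0 → 0≉1 (sym 1≈0)) (*-identityˡ 1#))))
                    (*-identityʳ C)

      -- undoing an ι twisted by a factor u; gives Δ⁻¹ on V after the ε's
      ι-unconj : ∀ {u f} → NZ u → NZ f → u * ι (ι f * u) ≈ f
      ι-unconj {u} {f} u≠0 f≠0 = begin
        u * ι (ι f * u)          ≈⟨ *-congˡ (ι-*ˡ (ι-nz f≠0) u≠0) ⟩
        u * (u ⁻¹ * ι (ι f))     ≈⟨ *-congˡ (*-congˡ (ι-involutive f≠0)) ⟩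
        u * (u ⁻¹ * f)           ≈⟨ sym (*-assoc _ _ _) ⟩
        (u * u ⁻¹) * f           ≈⟨ *-congʳ (inverseʳ u u≠0) ⟩
        1# * f                   ≈⟨ *-identityˡ f ⟩
        f                        ∎

      -- the new label at v as seen through Θ Δ⁻¹
      ι-conj : ∀ {u x} → NZ u → NZ x → ι (u * ι x) ≈ x * u ⁻¹
      ι-conj u≠0 x≠0 = trans (ι-*ʳ u≠0 (ι-nz x≠0)) (*-congʳ (ι-involutive x≠0))

      ι-ratioˡ : ∀ {f} u → NZ f → ι f ⁻¹ * ι u ≈ f * u ⁻¹
      ι-ratioˡ {f} u f≠0 = begin
        ι f ⁻¹ * (C * u ⁻¹)          ≈⟨ *-congʳ (ι-inverse f≠0) ⟩
        (f * C ⁻¹) * (C * u ⁻¹)      ≈⟨ *-assoc _ _ _ ⟩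
        f * (C ⁻¹ * (C * u ⁻¹))      ≈⟨ *-congˡ (cancelˡ (u ⁻¹) C≠0) ⟩
        f * u ⁻¹                     ∎

      ι-ratioʳ : ∀ u {w} → NZ w → ι u * ι w ⁻¹ ≈ u ⁻¹ * w
      ι-ratioʳ u {w} w≠0 = begin
        (C * u ⁻¹) * ι w ⁻¹          ≈⟨ *-congˡ (ι-inverse w≠0) ⟩
        (C * u ⁻¹) * (w * C ⁻¹)      ≈⟨ sym (*-assoc _ _ _) ⟩
        ((C * u ⁻¹) * w) * C ⁻¹      ≈⟨ *-congʳ (*-assoc _ _ _) ⟩
        (C * (u ⁻¹ * w)) * C ⁻¹      ≈⟨ C-conj (u ⁻¹ * w) ⟩
        u ⁻¹ * w                     ∎

module PosetFacts (P : FinPoset) where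
  open FinPoset P
  open IsDecPartialOrder isDecPartialOrder public
    using (isPartialOrder) renaming (refl to ≤-refl; trans to ≤-trans; antisym to ≤-antisym)

  <-irrefl : ∀ {x} → ¬ (x < x)
  <-irrefl (_ , x≢x) = x≢x ≡.refl

  <-≤-trans : ∀ {x y z} → x < y → y ≤ z → x < z
  <-≤-trans (x≤y , x≢y) y≤z = ≤-trans x≤y y≤z , λ { ≡.refl → x≢y (≤-antisym x≤y y≤z) }

  ≤-<-trans : ∀ {x y z} → x ≤ y → y < z → x < z
  ≤-<-trans x≤y (y≤z , y≢z) = ≤-trans x≤y y≤z , λ { ≡.refl → y≢z (≤-antisym y≤z x≤y) }

  <-trans : ∀ {x y z} → x < y → y < z → x < z
  <-trans x<y (y≤z , _) = <-≤-trans x<y y≤z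

  upper⇒⋖ : ∀ {x y} → y ∈ upperCovers x → x ⋖ y
  upper⇒⋖ {x} y∈ = proj₂ (∈-filter⁻ (λ u → x ⋖? u) {xs = allFin n} y∈)

  lower⇒⋖ : ∀ {x y} → y ∈ lowerCovers x → y ⋖ x
  lower⇒⋖ {x} y∈ = proj₂ (∈-filter⁻ (λ u → u ⋖? x) {xs = allFin n} y∈)

  up-induction : ∀ {q} (Q : Elt → Set q) → (∀ x → (∀ {y} → x < y → Q y) → Q x) → ∀ x → Q x
  up-induction Q = WF.All.wfRec (po-noetherian isPartialOrder) _ Q

  down-induction : ∀ {q} (Q : Elt → Set q) → (∀ x → (∀ {y} → y < x → Q y) → Q x) → ∀ x → Q x
  down-induction Q = WF.All.wfRec (po-wellFounded isPartialOrder) _ Q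

  unique-length : ∀ {xs : List Elt} → Unique xs → length xs ℕ.≤ n
  unique-length u = injective⇒≤ (lookup-injective u _ _)
    where
    lookup-injective : ∀ {xs : List Elt} → Unique xs → ∀ i j → lookup xs i ≡ lookup xs j → i ≡ j
    lookup-injective (_ ∷ _) Fin.zero Fin.zero _ = ≡.refl
    lookup-injective (x∉ ∷ _) Fin.zero (Fin.suc j) eq = ⊥-elim (All.lookup x∉ (∈-lookup j) eq)
    lookup-injective (x∉ ∷ _) (Fin.suc i) Fin.zero eq = ⊥-elim (All.lookup x∉ (∈-lookup i) (≡.sym eq))
    lookup-injective (_ ∷ u) (Fin.suc i) (Fin.suc j) eq = ≡.cong Fin.suc (lookup-injective u i j eq)

module ChainFuel (P : FinPoset) where
  open FinPoset P
  open PosetFacts P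

  extend : Elt → List Elt → (Elt → List (List Elt)) → List (List Elt)
  extend x [] chains = (x ∷ []) ∷ []
  extend x (y ∷ ys) chains = concatMap (λ z → map (x ∷_) (chains z)) (y ∷ ys)

  extend-cong : ∀ x ys {ch ch′ : Elt → List (List Elt)} →
                (∀ y → y ∈ ys → ch y ≡ ch′ y) → extend x ys ch ≡ extend x ys ch′
  extend-cong x [] _ = ≡.refl
  extend-cong x (y ∷ ys) {ch} {ch′} ch≡ch′ = concatMap-cong (y ∷ ys) ch≡ch′
    where
    concatMap-cong : ∀ zs → (∀ z → z ∈ zs → ch z ≡ ch′ z) →
                     concatMap (λ z → map (x ∷_) (ch z)) zs ≡ concatMap (λ z → map (x ∷_) (ch′ z)) zs
    concatMap-cong [] _ = ≡.refl
    concatMap-cong (z ∷ zs) eq = ≡.cong₂ _++_ (≡.cong (map (x ∷_)) (eq z (here ≡.refl)))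
                                          (concatMap-cong zs (λ w p → eq w (there p)))

  upChainsF-suc : ∀ k x → upChainsF (suc k) x ≡ extend x (upperCovers x) (upChainsF k)
  upChainsF-suc k x with upperCovers x
  ... | [] = ≡.refl
  ... | _ ∷ _ = ≡.refl

  downChainsF-suc : ∀ k x → downChainsF (suc k) x ≡ extend x (lowerCovers x) (downChainsF k)
  downChainsF-suc k x with lowerCovers x
  ... | [] = ≡.refl
  ... | _ ∷ _ = ≡.refl

  module Stable (R : Rel Elt 0ℓ) (R-irrefl : ∀ {x} → ¬ R x x)
                (R-trans : ∀ {x y z} → R x y → R y z → R x z)
                (cov : Elt → List Elt) (cov⊆R : ∀ {x y} → y ∈ cov x → R x y)
                (chains : ℕ → Elt → List (List Elt))
                (chains-suc : ∀ k x → chains (suc k) x ≡ extend x (cov x) (chains k)) where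

    -- fuel k suffices at y: n - k distinct elements lie R-below y, so an
    -- R-chain from y has at most k elements
    Enough : ℕ → Elt → Set
    Enough k y = Σ (List Elt) λ pre → All (λ p → R p y) pre × Unique pre × n ℕ.≤ length pre ℕ.+ k

    enough-cov : ∀ {k x y} → Enough (suc k) x → y ∈ cov x → Enough k y
    enough-cov {k} {x} (pre , pre<x , u , bound) y∈ =
      x ∷ pre , cov⊆R y∈ ∷ All.map (λ p<x → R-trans p<x (cov⊆R y∈)) pre<x ,
      All.map (λ p<x x≡p → R-irrefl (≡.subst (λ p → R p x) (≡.sym x≡p) p<x)) pre<x ∷ u ,
      ≡.subst (n ℕ.≤_) (ℕP.+-suc (length pre) k) bound

    -- fuel 0 never suffices, since the chain [y] needs one unit
    no-enough-zero : ∀ {y} → ¬ Enough 0 y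
    no-enough-zero {y} (pre , pre<y , u , bound) = ℕP.<-irrefl ≡.refl (ℕP.≤-trans y∷pre≤n bound′)
      where
      y∷pre≤n : suc (length pre) ℕ.≤ n
      y∷pre≤n = unique-length (All.map (λ p<y y≡p → R-irrefl (≡.subst (λ p → R p y) (≡.sym y≡p) p<y)) pre<y ∷ u)
      bound′ : n ℕ.≤ length pre
      bound′ = ≡.subst (n ℕ.≤_) (ℕP.+-identityʳ _) bound

    enough-top : ∀ {k} y → n ℕ.≤ k → Enough k y
    enough-top y n≤k = [] , [] , [] , n≤k

    fuel-irrelevant : ∀ k j y → Enough k y → Enough j y → chains k y ≡ chains j y
    fuel-irrelevant zero j y ek _ = ⊥-elim (no-enough-zero ek)
    fuel-irrelevant (suc k) zero y _ ej = ⊥-elim (no-enough-zero ej)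
    fuel-irrelevant (suc k) (suc j) y ek ej = begin
      chains (suc k) y               ≡⟨ chains-suc k y ⟩
      extend y (cov y) (chains k)    ≡⟨ extend-cong y (cov y) (λ z z∈ →
                                          fuel-irrelevant k j z (enough-cov ek z∈) (enough-cov ej z∈)) ⟩
      extend y (cov y) (chains j)    ≡⟨ ≡.sym (chains-suc j y) ⟩
      chains (suc j) y               ∎
      where open ≡.≡-Reasoning

    fuel-stable : ∀ y → chains n y ≡ chains (suc n) y
    fuel-stable y = fuel-irrelevant n (suc n) y (enough-top y ℕP.≤-refl) (enough-top y (ℕP.n≤1+n n))

  module Up = Stable _<_ <-irrefl <-trans upperCovers (proj₁ ∘ upper⇒⋖) upChainsF upChainsF-suc
  module Down = Stable (flip _<_) <-irrefl (flip <-trans) lowerCovers (proj₁ ∘ lower⇒⋖) downChainsF downChainsF-suc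

module Labelings {c ℓ} (S : SkewField c ℓ) (P : FinPoset) (C : SkewField.Carrier S) where
  open SkewField S
  open FinPoset P
  open Maps S P C public
  open DivisionRing S public
  open Twist C public
  open ListSums semiring using (sum-cong∈; sum-*ʳ; sum-*ˡ; sum-concatMap; sum-product; prod-++)
  open PosetFacts P public
  open ChainFuel P
  open import Relation.Binary.Reasoning.Setoid setoid
  open import Data.List.Membership.DecPropositional _≟P_ using (_∈?_)

  -- Σ φ over ys, or 1 if ys is empty (the value contributed by \hat 0 or \hat 1)
  sumOrOne : List Elt → (Elt → Carrier) → Carrier
  sumOrOne ys φ = sumL (hatLower φ ys)

  sumOrOne-cong : ∀ ys {φ ψ : Elt → Carrier} → (∀ y → y ∈ ys → φ y ≈ ψ y) → sumOrOne ys φ ≈ sumOrOne ys ψ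
  sumOrOne-cong [] _ = refl
  sumOrOne-cong (y ∷ ys) φ≈ψ = sum-cong∈ _ _ (y ∷ ys) φ≈ψ

  upSum upTail downSum downTail : ℕ → Lab → Elt → Carrier
  upSum k h x = sumL (map (λ ch → prodL (map h (reverse ch))) (upChainsF k x))
  upTail k h x = sumL (map (λ ch → prodL (map h (reverse (drop 1 ch)))) (upChainsF k x))
  downSum k h x = sumL (map (λ ch → prodL (map h ch)) (downChainsF k x))
  downTail k h x = sumL (map (λ ch → prodL (map h (drop 1 ch))) (downChainsF k x))

  sum-extend : ∀ (φ : List Elt → Carrier) x ys (chains : Elt → List (List Elt)) →
    sumL (map φ (concatMap (λ z → map (x ∷_) (chains z)) ys)) ≈
    sumL (map (λ z → sumL (map (λ c → φ (x ∷ c)) (chains z))) ys)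
  sum-extend φ x ys chains = trans (sum-concatMap φ _ ys)
    (reflexive (≡.cong sumL (ListP.map-cong (λ z → ≡.cong sumL (≡.sym (ListP.map-∘ (chains z)))) ys)))

  prod-reverse-∷ : ∀ (h : Lab) x c → prodL (map h (reverse (x ∷ c))) ≈ prodL (map h (reverse c)) * h x
  prod-reverse-∷ h x c = begin
    prodL (map h (reverse (x ∷ c)))        ≡⟨ ≡.cong (prodL ∘ map h) (ListP.unfold-reverse x c) ⟩
    prodL (map h (reverse c ++ [ x ]))     ≡⟨ ≡.cong prodL (ListP.map-++ h (reverse c) [ x ]) ⟩
    prodL (map h (reverse c) ++ [ h x ])   ≈⟨ prod-++ (map h (reverse c)) [ h x ] ⟩
    prodL (map h (reverse c)) * (h x * 1#) ≈⟨ *-congˡ (*-identityʳ _) ⟩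
    prodL (map h (reverse c)) * h x        ∎

  upSum-suc : ∀ k h x → upSum (suc k) h x ≈ sumOrOne (upperCovers x) (upSum k h) * h x
  upSum-suc k h x with upperCovers x
  -- for maximal x the only chain is [x]
  ... | [] = trans (+-identityʳ _) (trans (*-identityʳ _) (sym (trans (*-congʳ (+-identityʳ 1#)) (*-identityˡ _))))
  ... | y ∷ ys = begin
    _ ≈⟨ sum-extend φ x (y ∷ ys) (upChainsF k) ⟩
    sumL (map (λ z → sumL (map (λ c → φ (x ∷ c)) (upChainsF k z))) (y ∷ ys))
      ≈⟨ sum-cong∈ _ _ (y ∷ ys) (λ z _ →
           trans (sum-cong∈ _ _ (upChainsF k z) (λ c _ → prod-reverse-∷ h x c)) (sum-*ʳ φ (h x) (upChainsF k z))) ⟩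
    sumL (map (λ z → upSum k h z * h x) (y ∷ ys)) ≈⟨ sum-*ʳ (upSum k h) (h x) (y ∷ ys) ⟩
    sumL (map (upSum k h) (y ∷ ys)) * h x ∎
    where
    φ : List Elt → Carrier
    φ ch = prodL (map h (reverse ch))

  upTail-suc : ∀ k h x → upTail (suc k) h x ≈ sumOrOne (upperCovers x) (upSum k h)
  upTail-suc k h x with upperCovers x
  ... | [] = refl
  ... | y ∷ ys = sum-extend (λ ch → prodL (map h (reverse (drop 1 ch)))) x (y ∷ ys) (upChainsF k)

  downSum-suc : ∀ k h x → downSum (suc k) h x ≈ h x * sumOrOne (lowerCovers x) (downSum k h)
  downSum-suc k h x with lowerCovers x
  ... | [] = trans (+-identityʳ _) (*-congˡ (sym (+-identityʳ 1#)))
  ... | y ∷ ys = begin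
    _ ≈⟨ sum-extend φ x (y ∷ ys) (downChainsF k) ⟩
    sumL (map (λ z → sumL (map (λ c → h x * φ c) (downChainsF k z))) (y ∷ ys))
      ≈⟨ sum-cong∈ _ _ (y ∷ ys) (λ z _ → sum-*ˡ φ (h x) (downChainsF k z)) ⟩
    sumL (map (λ z → h x * downSum k h z) (y ∷ ys)) ≈⟨ sum-*ˡ (downSum k h) (h x) (y ∷ ys) ⟩
    h x * sumL (map (downSum k h) (y ∷ ys)) ∎
    where
    φ : List Elt → Carrier
    φ ch = prodL (map h ch)

  downTail-suc : ∀ k h x → downTail (suc k) h x ≈ sumOrOne (lowerCovers x) (downSum k h)
  downTail-suc k h x with lowerCovers x
  ... | [] = refl
  ... | y ∷ ys = sum-extend (λ ch → prodL (map h (drop 1 ch))) x (y ∷ ys) (downChainsF k)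

  U D A : Lab → Elt → Carrier
  U h x = sumOrOne (upperCovers x) (Δinv h)
  D h x = downSum n h x
  A h x = sumOrOne (lowerCovers x) (D h)

  Δinv-factor : ∀ h x → Δinv h x ≈ U h x * h x
  Δinv-factor h x = trans (reflexive (≡.cong (λ chs → sumL (map _ chs)) (Up.fuel-stable x))) (upSum-suc n h x)

  D-factor : ∀ h x → D h x ≈ h x * A h x
  D-factor h x = trans (reflexive (≡.cong (λ chs → sumL (map _ chs)) (Down.fuel-stable x))) (downSum-suc n h x)

  upTail-U : ∀ h x → upTail n h x ≈ U h x
  upTail-U h x = trans (reflexive (≡.cong (λ chs → sumL (map _ chs)) (Up.fuel-stable x))) (upTail-suc n h x)

  downTail-A : ∀ h x → downTail n h x ≈ A h x
  downTail-A h x = trans (reflexive (≡.cong (λ chs → sumL (map _ chs)) (Down.fuel-stable x))) (downTail-suc n h x)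

  -- the maximal chains through x split at x, so the antichain sums factor
  τsum-factor : ∀ h x → τsum h x ≈ A h x * Δinv h x
  τsum-factor h x = trans (sum-product (λ d → prodL (map h (drop 1 d))) (λ u → prodL (map h (reverse u)))
                                       (downChains x) (upChains x))
                          (*-congʳ (downTail-A h x))

  εsum-factor : ∀ h x → εsum h x ≈ D h x * U h x
  εsum-factor h x = trans (sum-product (λ d → prodL (map h d)) (λ u → prodL (map h (reverse (drop 1 u))))
                                       (downChains x) (upChains x))
                          (*-congˡ (upTail-U h x))

  Δinv-local : ∀ {h h′} x → (∀ {e} → x ≤ e → h e ≈ h′ e) → Δinv h x ≈ Δinv h′ x
  Δinv-local {h} {h′} = up-induction Q step
    where
    Q : Elt → Set _
    Q x = (∀ {e} → x ≤ e → h e ≈ h′ e) → Δinv h x ≈ Δinv h′ x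
    step : ∀ x → (∀ {y} → x < y → Q y) → Q x
    step x IH h≈h′ = begin
      Δinv h x         ≈⟨ Δinv-factor h x ⟩
      U h x * h x      ≈⟨ *-cong (sumOrOne-cong (upperCovers x) λ y y∈ →
                            IH (proj₁ (upper⇒⋖ y∈)) λ y≤e → h≈h′ (≤-trans (proj₁ (proj₁ (upper⇒⋖ y∈))) y≤e))
                                 (h≈h′ ≤-refl) ⟩
      U h′ x * h′ x    ≈⟨ sym (Δinv-factor h′ x) ⟩
      Δinv h′ x        ∎

  D-local : ∀ {h h′} x → (∀ {e} → e ≤ x → h e ≈ h′ e) → D h x ≈ D h′ x
  D-local {h} {h′} = down-induction Q step
    where
    Q : Elt → Set _
    Q x = (∀ {e} → e ≤ x → h e ≈ h′ e) → D h x ≈ D h′ x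
    step : ∀ x → (∀ {y} → y < x → Q y) → Q x
    step x IH h≈h′ = begin
      D h x            ≈⟨ D-factor h x ⟩
      h x * A h x      ≈⟨ *-cong (h≈h′ ≤-refl) (sumOrOne-cong (lowerCovers x) λ y y∈ →
                            IH (proj₁ (lower⇒⋖ y∈)) λ e≤y → h≈h′ (≤-trans e≤y (proj₁ (proj₁ (lower⇒⋖ y∈))))) ⟩
      h′ x * A h′ x    ≈⟨ sym (D-factor h′ x) ⟩
      D h′ x           ∎

  U-local : ∀ {h h′} x → (∀ {e} → x < e → h e ≈ h′ e) → U h x ≈ U h′ x
  U-local x h≈h′ = sumOrOne-cong (upperCovers x) λ y y∈ →
    Δinv-local y λ y≤e → h≈h′ (<-≤-trans (proj₁ (upper⇒⋖ y∈)) y≤e)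

  A-local : ∀ {h h′} x → (∀ {e} → e < x → h e ≈ h′ e) → A h x ≈ A h′ x
  A-local x h≈h′ = sumOrOne-cong (lowerCovers x) λ y y∈ →
    D-local y λ e≤y → h≈h′ (≤-<-trans e≤y (proj₁ (lower⇒⋖ y∈)))

  Comparable : Elt → Elt → Set
  Comparable e x = e ≤ x ⊎ x ≤ e

  Local : (Lab → Elt → Carrier) → Set _
  Local s = ∀ {h h′} x → (∀ {e} → Comparable e x → h e ≈ h′ e) → s h x ≈ s h′ x

  τsum-local : Local τsum
  τsum-local {h} {h′} x h≈h′ = begin
    τsum h x          ≈⟨ τsum-factor h x ⟩
    A h x * Δinv h x  ≈⟨ *-cong (A-local x (h≈h′ ∘ inj₁ ∘ proj₁)) (Δinv-local x (h≈h′ ∘ inj₂)) ⟩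
    A h′ x * Δinv h′ x ≈⟨ sym (τsum-factor h′ x) ⟩
    τsum h′ x         ∎

  εsum-local : Local εsum
  εsum-local {h} {h′} x h≈h′ = begin
    εsum h x          ≈⟨ εsum-factor h x ⟩
    D h x * U h x     ≈⟨ *-cong (D-local x (h≈h′ ∘ inj₁)) (U-local x (h≈h′ ∘ inj₂ ∘ proj₁)) ⟩
    D h′ x * U h′ x   ≈⟨ sym (εsum-factor h′ x) ⟩
    εsum h′ x         ∎

  update-same : ∀ f v a → update f v a v ≡ a
  update-same f v a with v ≟P v
  ... | yes _ = ≡.refl
  ... | no v≢v = ⊥-elim (v≢v ≡.refl)

  update-other : ∀ f v a {u} → u ≢ v → update f v a u ≡ f u
  update-other f v a {u} u≢v with u ≟P v
  ... | yes u≡v = ⊥-elim (u≢v u≡v)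
  ... | no _ = ≡.refl

  ≈-update : ∀ {h f : Lab} {v a} → h v ≈ a → (∀ {x} → x ≢ v → h x ≈ f x) → ∀ x → h x ≈ update f v a x
  ≈-update {h} {f} {v} {a} hv≈a h≈f x with x ≟P v
  ... | yes ≡.refl = hv≈a
  ... | no x≢v = h≈f x≢v

  compose-++-value : ∀ fs gs g → proj₂ (compose (fs ++ gs) g) ≡ proj₂ (compose fs (proj₂ (compose gs g)))
  compose-++-value [] gs g = ≡.refl
  compose-++-value (f ∷ fs) gs g = ≡.cong (proj₂ ∘ f) (compose-++-value fs gs g)

  compose-++-domain : ∀ fs gs g → proj₁ (compose (fs ++ gs) g) →
                      proj₁ (compose gs g) × proj₁ (compose fs (proj₂ (compose gs g)))
  compose-++-domain [] gs g dom = dom , tt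
  compose-++-domain (f ∷ fs) gs g (dom , f-dom) =
    proj₁ split , proj₂ split , ≡.subst (proj₁ ∘ f) (compose-++-value fs gs g) f-dom
    where split = compose-++-domain fs gs g dom

  toggle : (Lab → Elt → Carrier) → Elt → Lab → Pt ℓ Lab
  toggle s w h = inv? (s h w) >>= λ a → ret (update h w (C * a))

  IsAntichain : List Elt → Set
  IsAntichain ws = ∀ {a b} → a ∈ ws → b ∈ ws → Comparable a b → a ≡ b

  record Toggled (s : Lab → Elt → Carrier) (g : Lab) (ws : List Elt) (h : Lab) : Set (c ⊔ ℓ) where
    field
      nonzero : ∀ {x} → x ∈ ws → NZ (s g x)
      inside  : ∀ {x} → x ∈ ws → h x ≈ ι (s g x)
      outside : ∀ {x} → x ∉ ws → h x ≈ g x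

  -- toggling an antichain one element at a time = toggling it all at once,
  -- since no toggle sees a label changed by another
  toggle-antichain : ∀ {s} → Local s → ∀ ws g → Unique ws → IsAntichain ws →
    proj₁ (compose (map (toggle s) ws) g) → Toggled s g ws (proj₂ (compose (map (toggle s) ws) g))
  toggle-antichain s-local [] g _ _ _ = record { nonzero = λ () ; inside = λ () ; outside = λ _ → refl }
  toggle-antichain {s} s-local (w ∷ ws) g (w∉ws ∷ u) anti (dom , s≠0 , _) = record
    { nonzero = λ { (here ≡.refl) → nz-resp sG′≈sg s≠0 ; (there x∈) → IH.nonzero x∈ }
    ; inside  = λ { (here ≡.refl) → trans (reflexive (update-same G′ w _)) (ι-cong s≠0 sG′≈sg)
                  ; (there x∈) → trans (reflexive (update-other G′ w _ (≢w x∈))) (IH.inside x∈) }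
    ; outside = λ x∉ → trans (reflexive (update-other G′ w _ (λ { ≡.refl → x∉ (here ≡.refl) })))
                             (IH.outside (x∉ ∘ there))
    }
    where
    G′ = proj₂ (compose (map (toggle s) ws) g)
    module IH = Toggled (toggle-antichain s-local ws g u (λ a∈ b∈ → anti (there a∈) (there b∈)) dom)
    ≢w : ∀ {x} → x ∈ ws → x ≢ w
    ≢w x∈ x≡w = All.lookup w∉ws x∈ (≡.sym x≡w)
    G′≈g : ∀ {e} → Comparable e w → G′ e ≈ g e
    G′≈g {e} e~w with e ∈? ws
    ... | yes e∈ = ⊥-elim (≢w e∈ (anti (there e∈) (here ≡.refl) e~w))
    ... | no e∉ = IH.outside e∉
    sG′≈sg : s G′ w ≈ s g w
    sG′≈sg = s-local w G′≈g

  seqM-inv : ∀ zs → proj₂ (seqM (map inv? zs)) ≡ map _⁻¹ zs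
  seqM-inv [] = ≡.refl
  seqM-inv (z ∷ zs) = ≡.cong (z ⁻¹ ∷_) (seqM-inv zs)

  module _ (cen : Central S C) (C≠0 : NZ C) where
    open Laws cen C≠0

    psum-ι : ∀ ys (z : Elt → Carrier) → (∀ y → NZ (z y)) → NZ (sumOrOne ys z) →
             proj₂ (psum (hatUpper (ι ∘ z) ys)) ≈ ι (sumOrOne ys z)
    psum-ι [] z _ 1+0≠0 = begin
      (C ⁻¹ + 0#) ⁻¹  ≈⟨ inv-cong (nz-resp (sym (+-identityʳ _)) (nz-inv C≠0)) (+-identityʳ _) ⟩
      C ⁻¹ ⁻¹         ≈⟨ inv-inv C≠0 ⟩
      C               ≈⟨ sym ι-one ⟩
      ι 1#            ≈⟨ ι-cong (nz-resp (+-identityʳ _) 1+0≠0) (sym (+-identityʳ _)) ⟩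
      ι (1# + 0#)     ∎
    psum-ι (y ∷ ys) z z≠0 W≠0 = begin
      sumL (proj₂ (seqM (map inv? (map (ι ∘ z) (y ∷ ys))))) ⁻¹
        ≡⟨ ≡.cong (λ ws → sumL ws ⁻¹) (seqM-inv (map (ι ∘ z) (y ∷ ys))) ⟩
      sumL (map _⁻¹ (map (ι ∘ z) (y ∷ ys))) ⁻¹
        ≈⟨ inv-cong (nz-resp (sym Σ≈) (nz-* W≠0 (nz-inv C≠0))) Σ≈ ⟩
      (W * C ⁻¹) ⁻¹   ≈⟨ inv-* W≠0 (nz-inv C≠0) ⟩
      C ⁻¹ ⁻¹ * W ⁻¹  ≈⟨ *-congʳ (inv-inv C≠0) ⟩
      ι W             ∎
      where
      W = sumL (map z (y ∷ ys))
      Σ≈ : sumL (map _⁻¹ (map (ι ∘ z) (y ∷ ys))) ≈ W * C ⁻¹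
      Σ≈ = begin
        sumL (map _⁻¹ (map (ι ∘ z) (y ∷ ys))) ≡⟨ ≡.cong sumL (≡.sym (ListP.map-∘ (y ∷ ys))) ⟩
        sumL (map (λ u → ι (z u) ⁻¹) (y ∷ ys)) ≈⟨ sum-cong∈ _ _ (y ∷ ys) (λ u _ → ι-inverse (z≠0 u)) ⟩
        sumL (map (λ u → z u * C ⁻¹) (y ∷ ys)) ≈⟨ sum-*ʳ z (C ⁻¹) (y ∷ ys) ⟩
        W * C ⁻¹ ∎

module Commutation {c ℓ} (S : SkewField c ℓ) (P : FinPoset) (C : SkewField.Carrier S) (cen : Central S C)
                   (v : FinPoset.Elt P) (V : List (FinPoset.Elt P))
                   (V-covers : FinPoset.IsLowerCoverList P v V) where
  open SkewField S
  open FinPoset P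
  open Labelings S P C
  open import Relation.Binary.Reasoning.Setoid setoid
  open import Data.List.Relation.Binary.Permutation.Setoid.Properties (≡.setoid Elt)
    using (↭-reverse; Unique-resp-↭)
  open import Data.List.Relation.Binary.Permutation.Setoid (≡.setoid Elt) using (↭-sym)
  open import Data.List.Membership.DecPropositional _≟P_ using (_∈?_)

  V-unique : Unique V
  V-unique = proj₁ V-covers

  ∈V⇒⋖ : ∀ {u} → u ∈ V → u ⋖ v
  ∈V⇒⋖ = Equivalence.to (proj₂ V-covers _)

  ∈V⇒< : ∀ {u} → u ∈ V → u < v
  ∈V⇒< = proj₁ ∘ ∈V⇒⋖

  v∉V : v ∉ V
  v∉V = <-irrefl ∘ ∈V⇒<

  above-v : ∀ {e} → v ≤ e → e ∉ V
  above-v v≤e e∈V = <-irrefl (≤-<-trans v≤e (∈V⇒< e∈V))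

  V-antichain : IsAntichain V
  V-antichain {a} {b} a∈ b∈ (inj₁ a≤b) = comparable-covers a∈ b∈ a≤b
    where
    comparable-covers : ∀ {a b} → a ∈ V → b ∈ V → a ≤ b → a ≡ b
    comparable-covers {a} {b} a∈ b∈ a≤b with a ≟P b
    ... | yes a≡b = a≡b
    ... | no a≢b = ⊥-elim (proj₂ (∈V⇒⋖ a∈) (b , (a≤b , a≢b) , ∈V⇒< b∈))
  V-antichain a∈ b∈ (inj₂ b≤a) = ≡.sym (V-antichain b∈ a∈ (inj₁ b≤a))

  not-in-V : ∀ {y e} → y ∈ V → (e < y ⊎ y < e) → e ∉ V
  not-in-V y∈ (inj₁ (e≤y , e≢y)) e∈ = e≢y (V-antichain e∈ y∈ (inj₁ e≤y))
  not-in-V y∈ (inj₂ (y≤e , y≢e)) e∈ = y≢e (V-antichain y∈ e∈ (inj₁ y≤e))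

  -- the τ's of T*_v run through V in reverse order
  reverse-V-unique : Unique (reverse V)
  reverse-V-unique = Unique-resp-↭ (↭-sym (↭-reverse V)) V-unique

  reverse-V-antichain : IsAntichain (reverse V)
  reverse-V-antichain a∈ b∈ = V-antichain (AnyP.reverse⁻ a∈) (AnyP.reverse⁻ b∈)

  -- T*_v and E*_v: the τ's on V, then a toggle driven by s at v, then the ε's on V
  Star : (Lab → Elt → Carrier) → Lab → Pt ℓ Lab
  Star s = compose (map ε V ++ (toggle s v ∷ map τ (reverse V)))

  θ : Lab → Lab
  θ g x = ι (Δinv g x)

  -- Where Star s g is defined, Θ Δ⁻¹ (Star s g) differs from Θ Δ⁻¹ g only at v
  module Core (s : Lab → Elt → Carrier) (g : Lab) (dom : proj₁ (Star s g)) (C≠0 : NZ C) where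
    open Laws cen C≠0

    split = compose-++-domain (map ε V) (toggle s v ∷ map τ (reverse V)) g dom

    g₁ g₂ g₃ : Lab
    g₁ = proj₂ (compose (map τ (reverse V)) g)
    g₂ = update g₁ v (ι (s g₁ v))
    g₃ = proj₂ (compose (map ε V) g₂)

    s≠0 : NZ (s g₁ v)
    s≠0 = proj₁ (proj₂ (proj₁ split))

    star≡g₃ : proj₂ (Star s g) ≡ g₃
    star≡g₃ = compose-++-value (map ε V) (toggle s v ∷ map τ (reverse V)) g

    module T₁ = Toggled (toggle-antichain τsum-local (reverse V) g reverse-V-unique reverse-V-antichain
                                          (proj₁ (proj₁ split)))
    module T₃ = Toggled (toggle-antichain εsum-local V g₂ V-unique V-antichain (proj₂ split))

    g₁-out : ∀ {x} → x ∉ V → g₁ x ≈ g x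
    g₁-out x∉ = T₁.outside (x∉ ∘ AnyP.reverse⁻)

    g₂-off : ∀ {x} → x ≢ v → g₂ x ≈ g₁ x
    g₂-off x≢v = reflexive (update-other g₁ v _ x≢v)

    g₃-off : ∀ {x} → x ∉ V → x ≢ v → g₃ x ≈ g x
    g₃-off x∉ x≢v = trans (T₃.outside x∉) (trans (g₂-off x≢v) (g₁-out x∉))

    module OnV {y} (y∈V : y ∈ V) where
      τ≠0 : NZ (τsum g y)
      τ≠0 = T₁.nonzero (AnyP.reverse⁺ y∈V)

      A≠0 : NZ (A g y)
      A≠0 = nz-*ˡ (nz-resp (τsum-factor g y) τ≠0)

      Δ≠0 : NZ (Δinv g y)
      Δ≠0 = nz-*ʳ (nz-resp (τsum-factor g y) τ≠0)

      g₁-in : g₁ y ≈ ι (A g y * Δinv g y)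
      g₁-in = trans (T₁.inside (AnyP.reverse⁺ y∈V)) (ι-cong τ≠0 (τsum-factor g y))

      D₁ : D g₁ y ≈ θ g y
      D₁ = begin
        D g₁ y                             ≈⟨ D-factor g₁ y ⟩
        g₁ y * A g₁ y                      ≈⟨ *-cong g₁-in (A-local y λ e<y → g₁-out (not-in-V y∈V (inj₁ e<y))) ⟩
        ι (A g y * Δinv g y) * A g y       ≈⟨ ι-absorb A≠0 Δ≠0 ⟩
        θ g y                              ∎

      Δinv₃ : Δinv g₃ y ≈ Δinv g y
      Δinv₃ = begin
        Δinv g₃ y                  ≈⟨ Δinv-factor g₃ y ⟩
        U g₃ y * g₃ y              ≈⟨ *-cong (U-local y λ y<e → T₃.outside (not-in-V y∈V (inj₂ y<e)))
                                             (trans (T₃.inside y∈V) (ι-cong ε≠0 ε≈)) ⟩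
        U g₂ y * ι (θ g y * U g₂ y) ≈⟨ ι-unconj U≠0 Δ≠0 ⟩
        Δinv g y                   ∎
        where
        ε≠0 = T₃.nonzero y∈V
        ε≈ : εsum g₂ y ≈ θ g y * U g₂ y
        ε≈ = trans (εsum-factor g₂ y)
               (*-congʳ (trans (D-local y λ e≤y → g₂-off λ { ≡.refl → <-irrefl (≤-<-trans e≤y (∈V⇒< y∈V)) }) D₁))
        U≠0 : NZ (U g₂ y)
        U≠0 = nz-*ʳ (nz-resp ε≈ ε≠0)

    Δinv₃-off : ∀ x → x ≢ v → Δinv g₃ x ≈ Δinv g x
    Δinv₃-off = up-induction (λ x → x ≢ v → Δinv g₃ x ≈ Δinv g x) step
      where
      step : ∀ x → (∀ {y} → x < y → y ≢ v → Δinv g₃ y ≈ Δinv g y) → x ≢ v → Δinv g₃ x ≈ Δinv g x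
      step x IH x≢v with x ∈? V
      ... | yes x∈V = OnV.Δinv₃ x∈V
      ... | no x∉V = begin
        Δinv g₃ x        ≈⟨ Δinv-factor g₃ x ⟩
        U g₃ x * g₃ x    ≈⟨ *-cong (sumOrOne-cong (upperCovers x) λ y y∈ →
                               IH (proj₁ (upper⇒⋖ y∈)) λ { ≡.refl → x∉V (Equivalence.from (proj₂ V-covers x) (upper⇒⋖ y∈)) })
                             (g₃-off x∉V x≢v) ⟩
        U g x * g x      ≈⟨ sym (Δinv-factor g x) ⟩
        Δinv g x         ∎

    Δinv₃-v : Δinv g₃ v ≈ U g v * ι (s g₁ v)
    Δinv₃-v = trans (Δinv-factor g₃ v)
      (*-cong (U-local v λ v<e → g₃-off (above-v (proj₁ v<e)) λ { ≡.refl → <-irrefl v<e })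
              (trans (T₃.outside v∉V) (reflexive (update-same g₁ v _))))

    A₁-v : A g₁ v ≈ sumOrOne (lowerCovers v) (θ g)
    A₁-v = sumOrOne-cong (lowerCovers v) λ y y∈ →
      OnV.D₁ (Equivalence.from (proj₂ V-covers y) (lower⇒⋖ y∈))

    Δinv₁-v : Δinv g₁ v ≈ Δinv g v
    Δinv₁-v = Δinv-local v (g₁-out ∘ above-v)

    U₁-v : U g₁ v ≈ U g v
    U₁-v = U-local v (g₁-out ∘ above-v ∘ proj₁)

    g₁-v : g₁ v ≈ g v
    g₁-v = g₁-out v∉V

    conclude : (∀ x → NZ (Δinv (proj₂ (Star s g)) x)) → ∀ {a} → ι (U g v * ι (s g₁ v)) ≈ a →
               ∀ x → ι (Δinv (proj₂ (Star s g)) x) ≈ update (θ g) v a x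
    conclude Δ≠0 {a} at-v x = trans (reflexive (≡.cong (λ h → ι (Δinv h x)) star≡g₃))
                                    (≈-update (trans (ι-cong (Δ₃≠0 v) Δinv₃-v) at-v)
                                              (λ {y} y≢v → ι-cong (Δ₃≠0 y) (Δinv₃-off y y≢v)) x)
      where
      Δ₃≠0 : ∀ y → NZ (Δinv g₃ y)
      Δ₃≠0 y = ≡.subst (λ h → NZ (Δinv h y)) star≡g₃ (Δ≠0 y)

  commute-T : AgreeOnDomains (lhsT v V) (rhsT v V)
  commute-T g (dom , Δ≠0) (Δg≠0 , θv≠0 , _) = conclude Δ≠0 at-v
    where
    C≠0 = nz-*ˡ θv≠0
    open Core τsum g dom C≠0
    open Laws cen C≠0
    L = sumOrOne (lowerCovers v) (θ g)
    u = U g v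
    u≠0 : NZ u
    u≠0 = nz-*ˡ (nz-resp (Δinv-factor g v) (Δg≠0 v))
    τ≈ : τsum g₁ v ≈ L * Δinv g v
    τ≈ = trans (τsum-factor g₁ v) (*-cong A₁-v Δinv₁-v)
    at-v : ι (u * ι (τsum g₁ v)) ≈ (L * θ g v ⁻¹) * proj₂ (psum (hatUpper (θ g) (upperCovers v)))
    at-v = begin
      ι (u * ι (τsum g₁ v))    ≈⟨ ι-conj u≠0 s≠0 ⟩
      τsum g₁ v * u ⁻¹         ≈⟨ *-congʳ τ≈ ⟩
      (L * Δinv g v) * u ⁻¹    ≈⟨ *-assoc _ _ _ ⟩
      L * (Δinv g v * u ⁻¹)    ≈⟨ *-congˡ (sym (ι-ratioˡ u (Δg≠0 v))) ⟩
      L * (θ g v ⁻¹ * ι u)     ≈⟨ sym (*-assoc _ _ _) ⟩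
      (L * θ g v ⁻¹) * ι u     ≈⟨ *-congˡ (sym (psum-ι cen C≠0 (upperCovers v) (Δinv g) Δg≠0 u≠0)) ⟩
      (L * θ g v ⁻¹) * proj₂ (psum (hatUpper (θ g) (upperCovers v))) ∎

  commute-E : AgreeOnDomains (lhsE v V) (rhsE v V)
  commute-E g (dom , Δ≠0) (Δg≠0 , θv≠0 , _) = conclude Δ≠0 at-v
    where
    C≠0 = nz-*ˡ θv≠0
    open Core εsum g dom C≠0
    open Laws cen C≠0
    L = sumOrOne (lowerCovers v) (θ g)
    u = U g v
    ug≠0 : NZ (u * g v)
    ug≠0 = nz-resp (Δinv-factor g v) (Δg≠0 v)
    u≠0 : NZ u
    u≠0 = nz-*ˡ ug≠0
    ε≈ : εsum g₁ v ≈ (g v * L) * u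
    ε≈ = trans (εsum-factor g₁ v) (*-cong (trans (D-factor g₁ v) (*-cong g₁-v A₁-v)) U₁-v)
    at-v : ι (u * ι (εsum g₁ v)) ≈ (proj₂ (psum (hatUpper (θ g) (upperCovers v))) * θ g v ⁻¹) * L
    at-v = begin
      ι (u * ι (εsum g₁ v))           ≈⟨ ι-conj u≠0 s≠0 ⟩
      εsum g₁ v * u ⁻¹                ≈⟨ *-congʳ ε≈ ⟩
      ((g v * L) * u) * u ⁻¹          ≈⟨ cancelʳ (g v * L) u≠0 ⟩
      g v * L                         ≈⟨ *-congʳ (sym (cancelˡ (g v) u≠0)) ⟩
      (u ⁻¹ * (u * g v)) * L          ≈⟨ *-congʳ (sym (ι-ratioʳ u ug≠0)) ⟩
      (ι u * ι (u * g v) ⁻¹) * L      ≈⟨ *-congʳ (*-congˡ (inv-cong (ι-nz ug≠0) (ι-cong ug≠0 (sym (Δinv-factor g v))))) ⟩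
      (ι u * θ g v ⁻¹) * L            ≈⟨ *-congʳ (*-congʳ (sym (psum-ι cen C≠0 (upperCovers v) (Δinv g) Δg≠0 u≠0))) ⟩
      (proj₂ (psum (hatUpper (θ g) (upperCovers v))) * θ g v ⁻¹) * L ∎

theorem5p20 : ∀ {c ℓ k : Level} (S : SkewField c ℓ) → InfiniteSubfield S k →
    (C : SkewField.Carrier S) → Central S C →
    (P : FinPoset) (v : FinPoset.Elt P) (vs : List (FinPoset.Elt P)) →
    FinPoset.IsLowerCoverList P v vs →
    Maps.AgreeOnDomains S P C (Maps.lhsT S P C v vs) (Maps.rhsT S P C v vs)
    × Maps.AgreeOnDomains S P C (Maps.lhsE S P C v vs) (Maps.rhsE S P C v vs)
theorem5p20 S _ C central P v vs covers = commute-T , commute-E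
  where open Commutation S P C central v vs covers
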